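{- Let $r \ge 2$ be an integer and $\mathbf{m} = [m_2, m_3, \ldots]$ a type. Let $\mathbf{S} = \sum_{\mathbf{n} \ge 0} C_{\mathbf{n}}\mathbf{t}^{\mathbf{n}}$ with $C_{\mathbf{n}} = \dfrac{(E_{\mathbf{n}}-1)!}{(V_{\mathbf{n}}-1)!\,\mathbf{n}!}$. Then $$[\mathbf{t}^{\mathbf{m}}]\mathbf{S}^r = \frac{r\,(r-2+E_{\mathbf{m}})!}{(r-2+V_{\mathbf{m}})!\,\mathbf{m}!} = \frac{r\,(r-1+2m_2+3m_3+4m_4+\cdots)!}{(r+m_2+2m_3+3m_4+\cdots)!\,m_2!\,m_3!\,m_4!\cdots}.$$
   Context: A type is a vector $\mathbf{m} = [m_2, m_3, \ldots]$ of nonnegative integers with finitely many nonzero entries; $\mathbf{t}^{\mathbf{m}} = \prod_{k\ge2} t_k^{m_k}$ in formal power series in $t_2, t_3, \ldots$; $\mathbf{m}! = \prod_k m_k!$; $V_{\mathbf{m}} = 2 + \sum_{k\ge2}(k-1)m_k$; $E_{\mathbf{m}} = 1 + \sum_{k\ge2} k m_k$. ($C_{\mathbf{n}}$ equals the number of roofed dissections of a convex polygon of type $\mathbf{n}$.) -}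

module Defs where

open import Data.Nat as ℕ using (ℕ; zero; suc; _+_; _*_; _∸_; _!; NonZero)
open import Data.Nat.Properties using (m*n≢0; _!≢0)
open import Data.Integer using (+_)
open import Data.Rational using (ℚ; _/_; 0ℚ; 1ℚ)
import Data.Rational as Q
open import Data.Vec using (Vec; []; _∷_; zipWith)
open import Data.List using (List; []; _∷_; map; concatMap; upTo)
import Data.List as L

-- A type m = [m_2, m_3, ...] with m_k = 0 for k > d + 1 is represented by
-- the vector (m_2, m_3, ..., m_{d+1}) : Vec ℕ d.  Any type is representable
-- for d large enough (padding with zeros).
Type : ℕ → Set
Type d = Vec ℕ d

-- weighted sum  Σ_{j} (j + a) * m_{j+2}  (j = 0, 1, ...), i.e. Σ_k (k - 2 + a) m_k
wsum : ∀ {d} → ℕ → Type d → ℕ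
wsum a []       = 0
wsum a (x ∷ xs) = a * x + wsum (suc a) xs

V : ∀ {d} → Type d → ℕ
V m = 2 + wsum 1 m

E : ∀ {d} → Type d → ℕ
E m = 1 + wsum 2 m

mfact : ∀ {d} → Type d → ℕ
mfact []       = 1
mfact (x ∷ xs) = x ! * mfact xs

fact-nz : ∀ n → NonZero (n !)
fact-nz n = n !≢0

mfact-nz : ∀ {d} (m : Type d) → NonZero (mfact m)
mfact-nz []       = _
mfact-nz (x ∷ xs) = m*n≢0 (x !) (mfact xs) {{fact-nz x}} {{mfact-nz xs}}

prod-nz : ∀ {d} (a : ℕ) (m : Type d) → NonZero (a ! * mfact m)
prod-nz a m = m*n≢0 (a !) (mfact m) {{fact-nz a}} {{mfact-nz m}}

ratio : ∀ {d} → ℕ → ℕ → Type d → ℚ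
ratio a b m = ((+ (a !)) / (b ! * mfact m)) {{prod-nz b m}}

C : ∀ {d} → Type d → ℚ
C n = ratio (E n ∸ 1) (V n ∸ 1) n

-- formal power series in t_2, ..., t_{d+1} with rational coefficients,
-- given by their coefficient function
Series : ℕ → Set
Series d = Type d → ℚ

S : ∀ d → Series d
S d = C

below : ∀ {d} → Type d → List (Type d)
below []       = []  ∷ []
below (x ∷ xs) = concatMap (λ i → map (i ∷_) (below xs)) (upTo (suc x))

_-ᵗ_ : ∀ {d} → Type d → Type d → Type d
_-ᵗ_ = zipWith _∸_

sumℚ : List ℚ → ℚ
sumℚ = L.foldr Q._+_ 0ℚ

_⊛_ : ∀ {d} → Series d → Series d → Series d
(f ⊛ g) m = sumℚ (map (λ n → f n Q.* g (m -ᵗ n)) (below m))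

isZero : ∀ {d} → Type d → ℚ
isZero []          = 1ℚ
isZero (zero ∷ xs) = isZero xs
isZero (suc _ ∷ _) = 0ℚ

oneS : ∀ {d} → Series d
oneS = isZero

_^ˢ_ : ∀ {d} → Series d → ℕ → Series d
f ^ˢ zero  = oneS
f ^ˢ suc r = f ⊛ (f ^ˢ r)

{-# OPTIONS --safe #-}
-- Write P_r for the claimed closed form of S^r: P_0 = 1 and
-- P_r(n) = r (r - 2 + E_n)! / ((r - 2 + V_n)! n!) for r ≥ 1, so that P_1 = S.
-- The heart of the proof is the recurrence
--   P_{a+1} = P_a + Σ_k t_k P_{a+k}        (a ≥ 0),
-- which at a = 0 is the functional equation S = 1 + Σ_k t_k S^k in disguise.
-- At a fixed type n, all its terms are natural multiples of the single ratio
-- T = (a - 1 + Σ k n_k)! / ((a + 1 + Σ (k-1) n_k)! n!), and the multipliers satisfy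
--   (a + 1)(a + Σ k n_k) = a (a + 1 + Σ (k-1) n_k) + Σ (a + k) n_k.
-- Multiplying the recurrence by P_b and inducting on a gives P_a P_b = P_{a+b},
-- hence S^r = P_1^r = P_r.
module Submission where

open import Defs
open import Algebra.Bundles using (Ring; CommutativeMonoid)
open import Data.Fin using (Fin; zero; suc; toℕ)
open import Data.Integer as ℤ using (+_)
import Data.Integer.Properties as ℤP
open import Data.List as List using (List; []; _∷_; map; concatMap; applyUpTo; upTo; _++_)
import Data.List.Properties as List
open import Data.Nat as ℕ using (ℕ; zero; suc; pred; _≤_; _+_; _*_; _∸_; _!; s≤s; NonZero)
import Data.Nat.Properties as ℕP
open import Data.Nat.Tactic.RingSolver using (solve-∀)
open import Data.Product using (_×_; _,_; ∃-syntax)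
open import Data.Rational using (ℚ; 0ℚ; 1ℚ; _/_; toℚᵘ)
import Data.Rational as Q
import Data.Rational.Properties as QP
import Data.Rational.Unnormalised as ℚᵘ
import Data.Rational.Unnormalised.Properties as ℚᵘP
open import Data.Sum using (_⊎_; inj₁; inj₂)
open import Data.Vec as Vec using ([]; _∷_; lookup; updateAt; replicate)
import Data.Vec.Properties as Vec
open import Function using (_∘_; id; case_of_)
open import Relation.Binary.PropositionalEquality

open import Algebra.Properties.CommutativeSemigroup
  (CommutativeMonoid.commutativeSemigroup QP.+-0-commutativeMonoid) using (interchange)
open import Algebra.Properties.Semiring.Sum (Ring.semiring QP.+-*-ring)
  using (sum; sum-syntax; sum-cong-≗; sum-replicate-zero; ∑-distrib-+; *-distribʳ-sum)

toℚ : ℕ → ℚ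
toℚ n = + n / 1

toℚᵘ-/ : ∀ a b → toℚᵘ (+ a / suc b) ℚᵘ.≃ ℚᵘ.mkℚᵘ (+ a) b
toℚᵘ-/ a b = QP.toℚᵘ-fromℚᵘ (ℚᵘ.mkℚᵘ (+ a) b)

/-cross : ∀ a b a′ b′ .{{_ : NonZero b}} .{{_ : NonZero b′}} →
          a * b′ ≡ a′ * b → + a / b ≡ + a′ / b′
/-cross a (suc b) a′ (suc b′) eq =
  QP.fromℚᵘ-cong {ℚᵘ.mkℚᵘ (+ a) b} {ℚᵘ.mkℚᵘ (+ a′) b′} (ℚᵘ.*≡* (begin
    + a ℤ.* + suc b′  ≡⟨ ℤP.pos-* a (suc b′) ⟨
    + (a * suc b′)    ≡⟨ cong +_ eq ⟩
    + (a′ * suc b)    ≡⟨ ℤP.pos-* a′ (suc b) ⟩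
    + a′ ℤ.* + suc b  ∎))
  where open ≡-Reasoning

/-* : ∀ a b a′ b′ .{{_ : NonZero b}} .{{_ : NonZero b′}} →
      (+ a / b) Q.* (+ a′ / b′) ≡ (+ (a * a′) / (b * b′)) {{ℕP.m*n≢0 b b′}}
/-* a (suc b) a′ (suc b′) = QP.toℚᵘ-injective (begin
  toℚᵘ ((+ a / suc b) Q.* (+ a′ / suc b′))      ≈⟨ QP.toℚᵘ-homo-* (+ a / suc b) (+ a′ / suc b′) ⟩
  toℚᵘ (+ a / suc b) ℚᵘ.* toℚᵘ (+ a′ / suc b′)  ≈⟨ ℚᵘP.*-cong (toℚᵘ-/ a b) (toℚᵘ-/ a′ b′) ⟩
  ℚᵘ.mkℚᵘ (+ a ℤ.* + a′) (b′ ℕ.+ b * suc b′)    ≡⟨ cong (λ i → ℚᵘ.mkℚᵘ i _) (ℤP.pos-* a a′) ⟨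
  ℚᵘ.mkℚᵘ (+ (a * a′)) (b′ ℕ.+ b * suc b′)      ≈⟨ toℚᵘ-/ (a * a′) _ ⟨
  toℚᵘ (+ (a * a′) / (suc b * suc b′))          ∎)
  where open ℚᵘP.≃-Reasoning

/-+ : ∀ a b a′ b′ .{{_ : NonZero b}} .{{_ : NonZero b′}} →
      (+ a / b) Q.+ (+ a′ / b′) ≡ (+ (a * b′ + a′ * b) / (b * b′)) {{ℕP.m*n≢0 b b′}}
/-+ a (suc b) a′ (suc b′) = QP.toℚᵘ-injective (begin
  toℚᵘ ((+ a / suc b) Q.+ (+ a′ / suc b′))      ≈⟨ QP.toℚᵘ-homo-+ (+ a / suc b) (+ a′ / suc b′) ⟩
  toℚᵘ (+ a / suc b) ℚᵘ.+ toℚᵘ (+ a′ / suc b′)  ≈⟨ ℚᵘP.+-cong (toℚᵘ-/ a b) (toℚᵘ-/ a′ b′) ⟩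
  ℚᵘ.mkℚᵘ (+ a ℤ.* + suc b′ ℤ.+ + a′ ℤ.* + suc b) (b′ ℕ.+ b * suc b′)
    ≡⟨ cong (λ i → ℚᵘ.mkℚᵘ i _) numerator ⟩
  ℚᵘ.mkℚᵘ (+ (a * suc b′ + a′ * suc b)) (b′ ℕ.+ b * suc b′)
    ≈⟨ toℚᵘ-/ (a * suc b′ + a′ * suc b) _ ⟨
  toℚᵘ (+ (a * suc b′ + a′ * suc b) / (suc b * suc b′)) ∎)
  where
  open ℚᵘP.≃-Reasoning
  numerator : + a ℤ.* + suc b′ ℤ.+ + a′ ℤ.* + suc b ≡ + (a * suc b′ + a′ * suc b)
  numerator = trans (sym (cong₂ ℤ._+_ (ℤP.pos-* a (suc b′)) (ℤP.pos-* a′ (suc b))))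
                    (sym (ℤP.pos-+ (a * suc b′) (a′ * suc b)))

toℚ-+ : ∀ a b → toℚ (a + b) ≡ toℚ a Q.+ toℚ b
toℚ-+ a b = sym (trans (/-+ a 1 b 1)
  (cong (λ k → + k / 1) (cong₂ _+_ (ℕP.*-identityʳ a) (ℕP.*-identityʳ b))))

toℚ-* : ∀ a b → toℚ (a * b) ≡ toℚ a Q.* toℚ b
toℚ-* a b = sym (/-* a 1 b 1)

toℚ-*-assoc : ∀ a b q → toℚ a Q.* (toℚ b Q.* q) ≡ toℚ (a * b) Q.* q
toℚ-*-assoc a b q = trans (sym (QP.*-assoc (toℚ a) (toℚ b) q)) (cong (Q._* q) (sym (toℚ-* a b)))

ratio-rescale : ∀ {d} A B (m : Type d) c A′ B′ (m′ : Type d) →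
                A ! * (B′ ! * mfact m′) ≡ c * A′ ! * (B ! * mfact m) →
                ratio A B m ≡ toℚ c Q.* ratio A′ B′ m′
ratio-rescale A B m c A′ B′ m′ eq = sym (begin
  toℚ c Q.* ratio A′ B′ m′
    ≡⟨ /-* c 1 (A′ !) (B′ ! * mfact m′) {{_}} {{prod-nz B′ m′}} ⟩
  (+ (c * A′ !) / (1 * (B′ ! * mfact m′))) {{nz}}
    ≡⟨ /-cross (c * A′ !) (1 * (B′ ! * mfact m′)) (A !) (B ! * mfact m) {{nz}} {{prod-nz B m}}
               (trans (sym eq) (cong (A ! *_) (sym (ℕP.*-identityˡ _)))) ⟩
  ratio A B m ∎)
  where
  open ≡-Reasoning
  nz = ℕP.m*n≢0 1 (B′ ! * mfact m′) {{_}} {{prod-nz B′ m′}}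

ratio-suc-numerator : ∀ {d} A B (m : Type d) → ratio (suc A) B m ≡ toℚ (suc A) Q.* ratio A B m
ratio-suc-numerator A B m = ratio-rescale (suc A) B m (suc A) A B m refl

ratio-suc-denominator : ∀ {d} A B (m : Type d) → ratio A B m ≡ toℚ (suc B) Q.* ratio A (suc B) m
ratio-suc-denominator A B m =
  ratio-rescale A B m (suc B) A (suc B) m (reorder (A !) (suc B) (B !) (mfact m))
  where
  reorder : ∀ x y z w → x * ((y * z) * w) ≡ y * x * (z * w)
  reorder = solve-∀

wsum-+ : ∀ c k {d} (n : Type d) → wsum (c + k) n ≡ k * Vec.sum n + wsum c n
wsum-+ c k []       = sym (trans (ℕP.+-identityʳ (k * 0)) (ℕP.*-zeroʳ k))
wsum-+ c k (x ∷ xs) = begin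
  (c + k) * x + wsum (suc c + k) xs                 ≡⟨ cong (λ w → (c + k) * x + w) (wsum-+ (suc c) k xs) ⟩
  (c + k) * x + (k * Vec.sum xs + wsum (suc c) xs)  ≡⟨ reorder c k x (Vec.sum xs) (wsum (suc c) xs) ⟩
  k * (x + Vec.sum xs) + (c * x + wsum (suc c) xs)  ∎
  where
  open ≡-Reasoning
  reorder : ∀ c k x s w → (c + k) * x + (k * s + w) ≡ k * (x + s) + (c * x + w)
  reorder = solve-∀

wsum-updateAt : ∀ c {d} (j : Fin d) (n : Type d) {p} → lookup n j ≡ suc p →
                wsum c n ≡ c + toℕ j + wsum c (updateAt n j pred)
wsum-updateAt c zero    (_ ∷ xs) {p} refl = reorder c p (wsum (suc c) xs)
  where
  reorder : ∀ c p w → c * suc p + w ≡ c + 0 + (c * p + w)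
  reorder = solve-∀
wsum-updateAt c (suc j) (x ∷ xs) eq = begin
  c * x + wsum (suc c) xs
    ≡⟨ cong (λ w → c * x + w) (wsum-updateAt (suc c) j xs eq) ⟩
  c * x + (suc c + toℕ j + wsum (suc c) (updateAt xs j pred))
    ≡⟨ reorder c x (toℕ j) _ ⟩
  c + suc (toℕ j) + (c * x + wsum (suc c) (updateAt xs j pred)) ∎
  where
  open ≡-Reasoning
  reorder : ∀ c x t w → c * x + (suc c + t + w) ≡ c + suc t + (c * x + w)
  reorder = solve-∀

+-wsum-updateAt : ∀ a c {d} (j : Fin d) (n : Type d) {p} → lookup n j ≡ suc p →
                  a + wsum c n ≡ c + a + toℕ j + wsum c (updateAt n j pred)
+-wsum-updateAt a c j n eq =
  trans (cong (_+_ a) (wsum-updateAt c j n eq)) (reorder a c (toℕ j) (wsum c (updateAt n j pred)))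
  where
  reorder : ∀ a c t w → a + (c + t + w) ≡ c + a + t + w
  reorder = solve-∀

mfact-updateAt : ∀ {d} (j : Fin d) (n : Type d) {p} → lookup n j ≡ suc p →
                 mfact n ≡ suc p * mfact (updateAt n j pred)
mfact-updateAt zero    (_ ∷ xs) {p} refl = ℕP.*-assoc (suc p) (p !) (mfact xs)
mfact-updateAt (suc j) (x ∷ xs) {p} eq   = begin
  x ! * mfact xs                              ≡⟨ cong (x ! *_) (mfact-updateAt j xs eq) ⟩
  x ! * (suc p * mfact (updateAt xs j pred))  ≡⟨ reorder (x !) (suc p) _ ⟩
  suc p * (x ! * mfact (updateAt xs j pred))  ∎
  where
  open ≡-Reasoning
  reorder : ∀ a q m → a * (q * m) ≡ q * (a * m)
  reorder = solve-∀

ratio-updateAt : ∀ {d} A B (j : Fin d) (n : Type d) {p} → lookup n j ≡ suc p →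
                 ratio A B (updateAt n j pred) ≡ toℚ (suc p) Q.* ratio A B n
ratio-updateAt A B j n {p} eq = ratio-rescale A B n′ (suc p) A B n (begin
  A ! * (B ! * mfact n)                ≡⟨ cong (λ x → A ! * (B ! * x)) (mfact-updateAt j n eq) ⟩
  A ! * (B ! * (suc p * mfact n′))     ≡⟨ reorder (A !) (B !) (suc p) (mfact n′) ⟩
  suc p * A ! * (B ! * mfact n′)       ∎)
  where
  open ≡-Reasoning
  n′ = updateAt n j pred
  reorder : ∀ a b q m → a * (b * (q * m)) ≡ q * a * (b * m)
  reorder = solve-∀

wsum-replicate : ∀ c d → wsum c (replicate d 0) ≡ 0
wsum-replicate c zero    = refl
wsum-replicate c (suc d) =
  trans (cong (_+ wsum (suc c) (replicate d 0)) (ℕP.*-zeroʳ c)) (wsum-replicate (suc c) d)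

mfact-replicate : ∀ d → mfact (replicate d 0) ≡ 1
mfact-replicate zero    = refl
mfact-replicate (suc d) = trans (ℕP.+-identityʳ _) (mfact-replicate d)

isZero-replicate : ∀ d → isZero (replicate d 0) ≡ 1ℚ
isZero-replicate zero    = refl
isZero-replicate (suc d) = isZero-replicate d

zero-or-positive : ∀ c {d} (n : Type d) →
                   n ≡ replicate d 0 ⊎ (isZero n ≡ 0ℚ × ∃[ K ] wsum (suc c) n ≡ suc K)
zero-or-positive c []           = inj₁ refl
zero-or-positive c (zero ∷ xs)  with zero-or-positive (suc c) xs
... | inj₁ xs≡0                = inj₁ (cong (0 ∷_) xs≡0)
... | inj₂ (isZero≡0 , K , eq) =
  inj₂ (isZero≡0 , K , trans (cong (_+ wsum (suc (suc c)) xs) (ℕP.*-zeroʳ (suc c))) eq)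
zero-or-positive c (suc x ∷ xs) = inj₂ (refl , _ , refl)

sum-zero : ∀ k {h : Fin k → ℚ} → (∀ i → h i ≡ 0ℚ) → ∑[ i < k ] h i ≡ 0ℚ
sum-zero k h≡0 = trans (sum-cong-≗ h≡0) (sum-replicate-zero k)

wsum-as-∑ : ∀ c {d} (n : Type d) → ∑[ j < d ] toℚ ((c + toℕ j) * lookup n j) ≡ toℚ (wsum c n)
wsum-as-∑ c []       = refl
wsum-as-∑ c (x ∷ xs) = begin
  toℚ ((c + 0) * x) Q.+ ∑[ j < _ ] toℚ ((c + suc (toℕ j)) * lookup xs j)
    ≡⟨ cong₂ Q._+_ (cong (λ k → toℚ (k * x)) (ℕP.+-identityʳ c))
                   (sum-cong-≗ (λ j → cong (λ k → toℚ (k * lookup xs j)) (ℕP.+-suc c (toℕ j)))) ⟩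
  toℚ (c * x) Q.+ ∑[ j < _ ] toℚ ((suc c + toℕ j) * lookup xs j)
    ≡⟨ cong (toℚ (c * x) Q.+_) (wsum-as-∑ (suc c) xs) ⟩
  toℚ (c * x) Q.+ toℚ (wsum (suc c) xs)
    ≡⟨ toℚ-+ (c * x) _ ⟨
  toℚ (c * x + wsum (suc c) xs) ∎
  where open ≡-Reasoning

sumMap : ∀ {A : Set} → (A → ℚ) → List A → ℚ
sumMap f xs = sumℚ (map f xs)

sumMap-zero : ∀ {A : Set} {f : A → ℚ} (xs : List A) → (∀ x → f x ≡ 0ℚ) → sumMap f xs ≡ 0ℚ
sumMap-zero []       f≡0 = refl
sumMap-zero (x ∷ xs) f≡0 = cong₂ Q._+_ (f≡0 x) (sumMap-zero xs f≡0)

sumMap-+ : ∀ {A : Set} (f g : A → ℚ) (xs : List A) →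
           sumMap (λ x → f x Q.+ g x) xs ≡ sumMap f xs Q.+ sumMap g xs
sumMap-+ f g []       = refl
sumMap-+ f g (x ∷ xs) = trans (cong (f x Q.+ g x Q.+_) (sumMap-+ f g xs))
                              (interchange (f x) (g x) (sumMap f xs) (sumMap g xs))

sumMap-++ : ∀ {A : Set} (f : A → ℚ) (xs ys : List A) →
            sumMap f (xs ++ ys) ≡ sumMap f xs Q.+ sumMap f ys
sumMap-++ f []       ys = sym (QP.+-identityˡ _)
sumMap-++ f (x ∷ xs) ys = trans (cong (f x Q.+_) (sumMap-++ f xs ys)) (sym (QP.+-assoc (f x) _ _))

sumMap-concatMap : ∀ {A B : Set} (f : B → ℚ) (g : A → List B) (xs : List A) →
                   sumMap f (concatMap g xs) ≡ sumMap (λ x → sumMap f (g x)) xs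
sumMap-concatMap f g []       = refl
sumMap-concatMap f g (x ∷ xs) =
  trans (sumMap-++ f (g x) (concatMap g xs)) (cong (sumMap f (g x) Q.+_) (sumMap-concatMap f g xs))

sumMap-applyUpTo : ∀ (f : ℕ → ℚ) (g : ℕ → ℕ) k → sumMap f (applyUpTo g k) ≡ ∑[ i < k ] f (g (toℕ i))
sumMap-applyUpTo f g zero    = refl
sumMap-applyUpTo f g (suc k) = cong (f (g 0) Q.+_) (sumMap-applyUpTo f (g ∘ suc) k)

sumMap-∑-comm : ∀ {A : Set} k (h : A → Fin k → ℚ) (xs : List A) →
                sumMap (λ x → ∑[ j < k ] h x j) xs ≡ ∑[ j < k ] sumMap (λ x → h x j) xs
sumMap-∑-comm k h []       = sym (sum-replicate-zero k)
sumMap-∑-comm k h (x ∷ xs) =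
  trans (cong (sum (h x) Q.+_) (sumMap-∑-comm k h xs)) (sym (∑-distrib-+ (h x) _))

sum-below-∷ : ∀ {d} x (xs : Type d) (f : Type (suc d) → ℚ) →
              sumMap f (below (x ∷ xs)) ≡ ∑[ i < suc x ] sumMap (λ n → f (toℕ i ∷ n)) (below xs)
sum-below-∷ x xs f = begin
  sumMap f (concatMap (λ i → map (i ∷_) (below xs)) (upTo (suc x)))
    ≡⟨ sumMap-concatMap f (λ i → map (i ∷_) (below xs)) (upTo (suc x)) ⟩
  sumMap (λ i → sumMap f (map (i ∷_) (below xs))) (upTo (suc x))
    ≡⟨ sumMap-applyUpTo (λ i → sumMap f (map (i ∷_) (below xs))) id (suc x) ⟩
  ∑[ i < suc x ] sumMap f (map (toℕ i ∷_) (below xs))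
    ≡⟨ sum-cong-≗ {suc x} (λ i → cong sumℚ (sym (List.map-∘ {g = f} {f = toℕ i ∷_} (below xs)))) ⟩
  ∑[ i < suc x ] sumMap (λ n → f (toℕ i ∷ n)) (below xs) ∎
  where open ≡-Reasoning

ifPos : ℕ → ℚ → ℚ
ifPos zero    _ = 0ℚ
ifPos (suc _) q = q

∑-ifPos : ∀ k p (h : Fin k → ℚ) → ∑[ i < k ] ifPos p (h i) ≡ ifPos p (∑[ i < k ] h i)
∑-ifPos k zero    h = sum-replicate-zero k
∑-ifPos k (suc p) h = refl

-- f ↦ t_{j+2} f: entry j of a Type is the exponent of t_{j+2}.
mulVar : ∀ {d} → Fin d → Series d → Series d
mulVar j f n = ifPos (lookup n j) (f (updateAt n j pred))

mulVar-elim : ∀ {d} (j : Fin d) (f : Series d) (n : Type d) (g : ℕ → ℚ) → g 0 ≡ 0ℚ →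
              (∀ {p} → lookup n j ≡ suc p → f (updateAt n j pred) ≡ g (suc p)) →
              mulVar j f n ≡ g (lookup n j)
mulVar-elim j f n g g0≡0 f≡g = by-cases (lookup n j) refl
  where
  by-cases : ∀ q → lookup n j ≡ q → ifPos q (f (updateAt n j pred)) ≡ g q
  by-cases zero    _  = sym g0≡0
  by-cases (suc p) eq = f≡g eq

mulVar-cong : ∀ {d} (j : Fin d) {f g : Series d} (n : Type d) →
              (∀ {p} → lookup n j ≡ suc p → f (updateAt n j pred) ≡ g (updateAt n j pred)) →
              mulVar j f n ≡ mulVar j g n
mulVar-cong j {f} {g} n = mulVar-elim j f n (λ q → ifPos q (g (updateAt n j pred))) refl

⊛-cong : ∀ {d} {f f′ g g′ : Series d} → f ≗ f′ → g ≗ g′ → (f ⊛ g) ≗ (f′ ⊛ g′)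
⊛-cong f≗f′ g≗g′ m =
  cong sumℚ (List.map-cong (λ n → cong₂ Q._*_ (f≗f′ n) (g≗g′ (m -ᵗ n))) (below m))

oneS-⊛ : ∀ {d} (f : Series d) → (oneS ⊛ f) ≗ f
oneS-⊛ f []       = trans (QP.+-identityʳ _) (QP.*-identityˡ _)
oneS-⊛ f (x ∷ xs) = begin
  (oneS ⊛ f) (x ∷ xs)
    ≡⟨ sum-below-∷ x xs _ ⟩
  (oneS ⊛ (f ∘ (x ∷_))) xs Q.+ ∑[ i < x ] rest i
    ≡⟨ cong₂ Q._+_ (oneS-⊛ (f ∘ (x ∷_)) xs) (sum-zero x rest≡0) ⟩
  f (x ∷ xs) Q.+ 0ℚ
    ≡⟨ QP.+-identityʳ _ ⟩
  f (x ∷ xs) ∎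
  where
  open ≡-Reasoning
  rest : Fin x → ℚ
  rest i = sumMap (λ n → 0ℚ Q.* f ((x ∸ suc (toℕ i)) ∷ (xs -ᵗ n))) (below xs)
  rest≡0 : ∀ i → rest i ≡ 0ℚ
  rest≡0 i = sumMap-zero (below xs) (λ n → QP.*-zeroˡ (f ((x ∸ suc (toℕ i)) ∷ (xs -ᵗ n))))

⊛-distribʳ-+ : ∀ {d} (f g h : Series d) m →
               ((λ n → f n Q.+ g n) ⊛ h) m ≡ (f ⊛ h) m Q.+ (g ⊛ h) m
⊛-distribʳ-+ f g h m =
  trans (cong sumℚ (List.map-cong (λ n → QP.*-distribʳ-+ (h (m -ᵗ n)) (f n) (g n)) (below m)))
        (sumMap-+ (λ n → f n Q.* h (m -ᵗ n)) (λ n → g n Q.* h (m -ᵗ n)) (below m))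

⊛-distribʳ-∑ : ∀ {d} k (f : Fin k → Series d) (h : Series d) m →
               ((λ n → ∑[ j < k ] f j n) ⊛ h) m ≡ ∑[ j < k ] (f j ⊛ h) m
⊛-distribʳ-∑ k f h m =
  trans (cong sumℚ (List.map-cong (λ n → *-distribʳ-sum (h (m -ᵗ n)) (λ j → f j n)) (below m)))
        (sumMap-∑-comm k (λ n j → f j n Q.* h (m -ᵗ n)) (below m))

mulVar-⊛ : ∀ {d} (j : Fin d) (f g : Series d) → (mulVar j f ⊛ g) ≗ mulVar j (f ⊛ g)
mulVar-⊛ zero f g (x ∷ xs) = begin
  (mulVar zero f ⊛ g) (x ∷ xs)                                       ≡⟨ sum-below-∷ x xs _ ⟩
  sumMap (λ n → 0ℚ Q.* g (x ∷ (xs -ᵗ n))) (below xs) Q.+ shifted x  ≡⟨ cong (Q._+ shifted x) first≡0 ⟩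
  0ℚ Q.+ shifted x                                                   ≡⟨ QP.+-identityˡ _ ⟩
  shifted x                                                          ≡⟨ shifted≡ x ⟩
  mulVar zero (f ⊛ g) (x ∷ xs)                                       ∎
  where
  open ≡-Reasoning
  first≡0 : sumMap (λ n → 0ℚ Q.* g (x ∷ (xs -ᵗ n))) (below xs) ≡ 0ℚ
  first≡0 = sumMap-zero (below xs) (λ n → QP.*-zeroˡ (g (x ∷ (xs -ᵗ n))))
  shifted : ℕ → ℚ
  shifted y = ∑[ i < y ] sumMap (λ n → f (toℕ i ∷ n) Q.* g ((y ∸ suc (toℕ i)) ∷ (xs -ᵗ n))) (below xs)
  shifted≡ : ∀ y → shifted y ≡ ifPos y ((f ⊛ g) (pred y ∷ xs))
  shifted≡ zero    = refl
  shifted≡ (suc y) = sym (sum-below-∷ y xs _)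
mulVar-⊛ (suc j) f g (x ∷ xs) = begin
  (mulVar (suc j) f ⊛ g) (x ∷ xs)
    ≡⟨ sum-below-∷ x xs _ ⟩
  ∑[ i < suc x ] (mulVar j (fᵢ i) ⊛ gᵢ i) xs
    ≡⟨ sum-cong-≗ {suc x} (λ i → mulVar-⊛ j (fᵢ i) (gᵢ i) xs) ⟩
  ∑[ i < suc x ] ifPos (lookup xs j) ((fᵢ i ⊛ gᵢ i) xs′)
    ≡⟨ ∑-ifPos (suc x) (lookup xs j) (λ i → (fᵢ i ⊛ gᵢ i) xs′) ⟩
  ifPos (lookup xs j) (∑[ i < suc x ] (fᵢ i ⊛ gᵢ i) xs′)
    ≡⟨ cong (ifPos (lookup xs j)) (sum-below-∷ x xs′ _) ⟨
  mulVar (suc j) (f ⊛ g) (x ∷ xs) ∎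
  where
  open ≡-Reasoning
  xs′ = updateAt xs j pred
  fᵢ gᵢ : Fin (suc x) → Series _
  fᵢ i = f ∘ (toℕ i ∷_)
  gᵢ i = g ∘ ((x ∸ toℕ i) ∷_)

-- P_r of the header. The formula for r ≥ 1 would give 0 at r = 0, where S^0 = 1.
powS : ∀ {d} → ℕ → Series d
powS zero      = oneS
powS (suc r) n = toℚ (suc r) Q.* ratio (r + wsum 2 n) (suc r + wsum 1 n) n

-- Σ_k t_k P_{a+k}, with k = j + 2.
ΔpowS : ∀ {d} → ℕ → Series d
ΔpowS {d} a n = ∑[ j < d ] mulVar j (powS (2 + a + toℕ j)) n

recurrence-multipliers : ∀ {d} a (n : Type d) {K} → a + wsum 2 n ≡ suc K →
                         suc a * suc K ≡ a * (suc a + wsum 1 n) + wsum (2 + a) n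
recurrence-multipliers a n {K} eq = begin
  suc a * suc K                            ≡⟨ cong (suc a *_) eq ⟨
  suc a * (a + wsum 2 n)                   ≡⟨ cong (λ w → suc a * (a + w)) wsum₂ ⟩
  suc a * (a + (1 * Σ + W))                ≡⟨ identity a Σ W ⟩
  a * (suc a + W) + (a * Σ + (1 * Σ + W))  ≡⟨ cong (λ w → a * (suc a + W) + (a * Σ + w)) wsum₂ ⟨
  a * (suc a + W) + (a * Σ + wsum 2 n)     ≡⟨ cong (λ w → a * (suc a + W) + w) (wsum-+ 2 a n) ⟨
  a * (suc a + W) + wsum (2 + a) n         ∎
  where
  open ≡-Reasoning
  Σ = Vec.sum n
  W = wsum 1 n
  wsum₂ : wsum 2 n ≡ 1 * Σ + W
  wsum₂ = wsum-+ 1 1 n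
  identity : ∀ a s w → suc a * (a + (1 * s + w)) ≡ a * (suc a + w) + (a * s + (1 * s + w))
  identity = solve-∀

module _ {d} (a : ℕ) (n : Type d) {K : ℕ} (a+wsum≡1+K : a + wsum 2 n ≡ suc K) where

  private
    W = wsum 1 n
    T = ratio K (suc a + W) n

  powS-suc-scaled : powS (suc a) n ≡ toℚ (suc a * suc K) Q.* T
  powS-suc-scaled = begin
    toℚ (suc a) Q.* ratio (a + wsum 2 n) (suc a + W) n
      ≡⟨ cong (λ k → toℚ (suc a) Q.* ratio k (suc a + W) n) a+wsum≡1+K ⟩
    toℚ (suc a) Q.* ratio (suc K) (suc a + W) n
      ≡⟨ cong (toℚ (suc a) Q.*_) (ratio-suc-numerator K (suc a + W) n) ⟩
    toℚ (suc a) Q.* (toℚ (suc K) Q.* T)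
      ≡⟨ toℚ-*-assoc (suc a) (suc K) T ⟩
    toℚ (suc a * suc K) Q.* T ∎
    where open ≡-Reasoning

  mulVar-powS-scaled : ∀ j → mulVar j (powS (2 + a + toℕ j)) n ≡ toℚ ((2 + a + toℕ j) * lookup n j) Q.* T
  mulVar-powS-scaled j = mulVar-elim j (powS k) n (λ q → toℚ (k * q) Q.* T)
    (trans (cong (λ i → toℚ i Q.* T) (ℕP.*-zeroʳ k)) (QP.*-zeroˡ T)) powS-scaled
    where
    k = 2 + a + toℕ j
    powS-scaled : ∀ {p} → lookup n j ≡ suc p → powS k (updateAt n j pred) ≡ toℚ (k * suc p) Q.* T
    powS-scaled {p} eq = begin
      toℚ k Q.* ratio (suc a + toℕ j + wsum 2 n′) (k + wsum 1 n′) n′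
        ≡⟨ cong₂ (λ A B → toℚ k Q.* ratio A B n′) numerator denominator ⟩
      toℚ k Q.* ratio K (suc a + W) n′
        ≡⟨ cong (toℚ k Q.*_) (ratio-updateAt K (suc a + W) j n eq) ⟩
      toℚ k Q.* (toℚ (suc p) Q.* T)
        ≡⟨ toℚ-*-assoc k (suc p) T ⟩
      toℚ (k * suc p) Q.* T ∎
      where
      open ≡-Reasoning
      n′ = updateAt n j pred
      numerator : suc a + toℕ j + wsum 2 n′ ≡ K
      numerator = ℕP.suc-injective (trans (sym (+-wsum-updateAt a 2 j n eq)) a+wsum≡1+K)
      denominator : k + wsum 1 n′ ≡ suc a + W
      denominator = sym (+-wsum-updateAt (suc a) 1 j n eq)

  ΔpowS-scaled : ΔpowS a n ≡ toℚ (wsum (2 + a) n) Q.* T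
  ΔpowS-scaled = begin
    ∑[ j < d ] mulVar j (powS (2 + a + toℕ j)) n
      ≡⟨ sum-cong-≗ mulVar-powS-scaled ⟩
    ∑[ j < d ] (toℚ ((2 + a + toℕ j) * lookup n j) Q.* T)
      ≡⟨ *-distribʳ-sum T (λ j → toℚ ((2 + a + toℕ j) * lookup n j)) ⟨
    (∑[ j < d ] toℚ ((2 + a + toℕ j) * lookup n j)) Q.* T
      ≡⟨ cong (Q._* T) (wsum-as-∑ (2 + a) n) ⟩
    toℚ (wsum (2 + a) n) Q.* T ∎
    where open ≡-Reasoning

  -- The hypothesis holds for a ≥ 1 (powS-suc-rescaled) and for a = 0 at every n ≠ 0.
  powS-rec-scaled : powS a n ≡ toℚ (a * (suc a + W)) Q.* T → powS (suc a) n ≡ powS a n Q.+ ΔpowS a n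
  powS-rec-scaled powS≡ = begin
    powS (suc a) n
      ≡⟨ powS-suc-scaled ⟩
    toℚ (suc a * suc K) Q.* T
      ≡⟨ cong (λ k → toℚ k Q.* T) (recurrence-multipliers a n a+wsum≡1+K) ⟩
    toℚ (a * (suc a + W) + wsum (2 + a) n) Q.* T
      ≡⟨ cong (Q._* T) (toℚ-+ (a * (suc a + W)) (wsum (2 + a) n)) ⟩
    (toℚ (a * (suc a + W)) Q.+ toℚ (wsum (2 + a) n)) Q.* T
      ≡⟨ QP.*-distribʳ-+ T (toℚ (a * (suc a + W))) (toℚ (wsum (2 + a) n)) ⟩
    toℚ (a * (suc a + W)) Q.* T Q.+ toℚ (wsum (2 + a) n) Q.* T
      ≡⟨ cong₂ Q._+_ powS≡ ΔpowS-scaled ⟨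
    powS a n Q.+ ΔpowS a n ∎
    where open ≡-Reasoning

powS-suc-rescaled : ∀ {d} a (n : Type d) →
  powS (suc a) n ≡ toℚ (suc a * (2 + a + wsum 1 n)) Q.* ratio (a + wsum 2 n) (2 + a + wsum 1 n) n
powS-suc-rescaled a n = begin
  toℚ (suc a) Q.* ratio K (suc a + W) n
    ≡⟨ cong (toℚ (suc a) Q.*_) (ratio-suc-denominator K (suc a + W) n) ⟩
  toℚ (suc a) Q.* (toℚ (2 + a + W) Q.* ratio K (2 + a + W) n)
    ≡⟨ toℚ-*-assoc (suc a) (2 + a + W) (ratio K (2 + a + W) n) ⟩
  toℚ (suc a * (2 + a + W)) Q.* ratio K (2 + a + W) n ∎
  where
  open ≡-Reasoning
  K = a + wsum 2 n
  W = wsum 1 n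

powS-rec-replicate : ∀ d → powS 1 (replicate d 0) ≡ powS 0 (replicate d 0) Q.+ ΔpowS 0 (replicate d 0)
powS-rec-replicate d = begin
  powS 1 0ᵈ                      ≡⟨ powS₁≡1 ⟩
  1ℚ Q.+ 0ℚ                      ≡⟨ cong₂ Q._+_ (isZero-replicate d) Δ≡0 ⟨
  isZero 0ᵈ Q.+ ΔpowS 0 0ᵈ       ∎
  where
  open ≡-Reasoning
  0ᵈ = replicate d 0
  powS₁≡1 : powS 1 0ᵈ ≡ 1ℚ
  powS₁≡1 = begin
    toℚ 1 Q.* ratio (wsum 2 0ᵈ) (1 + wsum 1 0ᵈ) 0ᵈ
      ≡⟨ QP.*-identityˡ (ratio (wsum 2 0ᵈ) (1 + wsum 1 0ᵈ) 0ᵈ) ⟩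
    ratio (wsum 2 0ᵈ) (1 + wsum 1 0ᵈ) 0ᵈ
      ≡⟨ cong₂ (λ A B → ratio A (suc B) 0ᵈ) (wsum-replicate 2 d) (wsum-replicate 1 d) ⟩
    ratio 0 1 0ᵈ
      ≡⟨ /-cross 1 (1 * mfact 0ᵈ) 1 1 {{prod-nz 1 0ᵈ}}
                 (cong (1 *_) (sym (trans (ℕP.*-identityˡ _) (mfact-replicate d)))) ⟩
    1ℚ ∎
  Δ≡0 : ΔpowS 0 0ᵈ ≡ 0ℚ
  Δ≡0 = sum-zero d (λ j →
    cong (λ k → ifPos k (powS (2 + toℕ j) (updateAt 0ᵈ j pred))) (Vec.lookup-replicate j 0))

powS-rec : ∀ {d} a (n : Type d) → powS (suc a) n ≡ powS a n Q.+ ΔpowS a n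
powS-rec {d} zero n = case zero-or-positive 1 n of λ where
  (inj₁ refl)                → powS-rec-replicate d
  (inj₂ (isZero≡0 , K , eq)) →
    powS-rec-scaled 0 n eq (trans isZero≡0 (sym (QP.*-zeroˡ (ratio K (1 + wsum 1 n) n))))
powS-rec (suc a) n = powS-rec-scaled (suc a) n refl (powS-suc-rescaled a n)

-- Both recursive calls have measure a + wsum 2 m, one below the current one: in the second,
-- removing t_{j+2} from m lowers wsum 2 by 2 + j while the exponent grows from 1 + a to 2 + a + j.
powS-⊛ : ∀ {d} fuel a b (m : Type d) → a + wsum 2 m ≤ fuel → (powS a ⊛ powS b) m ≡ powS (a + b) m
powS-⊛ _          zero    b m _           = oneS-⊛ (powS b) m
powS-⊛ {d} (suc fuel) (suc a) b m (s≤s bound) = begin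
  (powS (suc a) ⊛ powS b) m                     ≡⟨ ⊛-cong {g = powS b} (powS-rec a) (λ _ → refl) m ⟩
  ((λ n → powS a n Q.+ ΔpowS a n) ⊛ powS b) m   ≡⟨ ⊛-distribʳ-+ (powS a) (ΔpowS a) (powS b) m ⟩
  (powS a ⊛ powS b) m Q.+ (ΔpowS a ⊛ powS b) m  ≡⟨ cong₂ Q._+_ (powS-⊛ fuel a b m bound) ΔpowS-⊛ ⟩
  powS (a + b) m Q.+ ΔpowS (a + b) m            ≡⟨ powS-rec (a + b) m ⟨
  powS (suc a + b) m                            ∎
  where
  open ≡-Reasoning
  Pₐ Pₐ₊ᵦ : Fin d → Series d
  Pₐ   j = powS (2 + a + toℕ j)
  Pₐ₊ᵦ j = powS (2 + (a + b) + toℕ j)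
  term-⊛ : ∀ j → mulVar j (Pₐ j ⊛ powS b) m ≡ mulVar j (Pₐ₊ᵦ j) m
  term-⊛ j = mulVar-cong j {Pₐ j ⊛ powS b} {Pₐ₊ᵦ j} m λ eq →
    trans (powS-⊛ fuel (2 + a + toℕ j) b m′ (subst (_≤ fuel) (+-wsum-updateAt a 2 j m eq) bound))
          (cong (λ r → powS r m′) (reorder a (toℕ j) b))
    where
    m′ = updateAt m j pred
    reorder : ∀ a t b → 2 + a + t + b ≡ 2 + (a + b) + t
    reorder = solve-∀
  ΔpowS-⊛ : (ΔpowS a ⊛ powS b) m ≡ ΔpowS (a + b) m
  ΔpowS-⊛ = begin
    (ΔpowS a ⊛ powS b) m                   ≡⟨ ⊛-distribʳ-∑ d (λ j → mulVar j (Pₐ j)) (powS b) m ⟩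
    ∑[ j < d ] (mulVar j (Pₐ j) ⊛ powS b) m ≡⟨ sum-cong-≗ (λ j → mulVar-⊛ j (Pₐ j) (powS b) m) ⟩
    ∑[ j < d ] mulVar j (Pₐ j ⊛ powS b) m   ≡⟨ sum-cong-≗ term-⊛ ⟩
    ΔpowS (a + b) m                        ∎

^ˢ≗powS : ∀ {d} r → S d ^ˢ r ≗ powS r
^ˢ≗powS zero    m = refl
^ˢ≗powS (suc r) m = trans (⊛-cong (λ n → sym (QP.*-identityˡ (C n))) (^ˢ≗powS r) m)
                          (powS-⊛ (1 + wsum 2 m) 1 r m ℕP.≤-refl)

theorem7 : (r : ℕ) → 2 ≤ r → (d : ℕ) → (m : Type d) →
    (S d ^ˢ r) m ≡ Q._*_ (Q._/_ (+ r) 1) (ratio ((r ∸ 2) + E m) ((r ∸ 2) + V m) m)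
theorem7 (suc (suc r)) _ d m = trans (^ˢ≗powS (2 + r) m)
  (cong₂ (λ A B → toℚ (2 + r) Q.* ratio A B m)
         (sym (ℕP.+-suc r (wsum 2 m)))
         (sym (trans (ℕP.+-suc r _) (cong suc (ℕP.+-suc r (wsum 1 m))))))
theorem7 1 (s≤s ())
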